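{- Consider unit-demand CVRP with capacity $k\geq3$, let $I^*$ be an optimal itinerary in which each tour is a simple cycle through $v_0$ visiting exactly $k$ customers, let $\chi=w(h(I^*))/w(I^*)$, and let $\Delta=\sum_{v_i\in V}w(v_0,v_i)$. Then $\frac{k}{2}w(I^*)\geq\left(\chi+\frac{k-2}{2}\right)w(I^*)\geq\Delta$.
   Context: Unit-demand CVRP: complete graph $G$ on $V\cup\{v_0\}$ ($V=\{v_1,\dots,v_n\}$ customers each of demand 1, $v_0$ depot), nonnegative symmetric edge weight $w$ satisfying the triangle inequality, capacity $k$; a tour is a cycle through $v_0$ serving at most $k$ customers; an itinerary is a set of tours serving all customers, with weight $w(I)$ the total weight of its edges. Standing assumption of the paper: there is an optimal itinerary $I^*$ in which every tour is a simple cycle $(v_0,u_1,\dots,u_k,v_0)$ serving exactly $k$ customers (tours pairwise meet only at $v_0$). Home-edges: the edges of $I^*$ incident to $v_0$; $h(I^*)$ denotes their set; $w(I^*)>0$ is assumed.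
   Formalization: The edge weights w take nonnegative rational values rather than nonnegative real ones. -}

module Defs where

open import Data.Nat as ℕ using (ℕ; zero; suc)
open import Data.Fin using (Fin; zero; suc)
open import Data.List using (List; []; _∷_; map; concat; length; allFin)
open import Data.List.Membership.Propositional using (_∈_)
open import Data.List.Relation.Unary.Unique.Propositional using (Unique)
open import Data.List.Relation.Unary.Any using (Any)
open import Data.List.Relation.Binary.Permutation.Propositional using (_↭_)
open import Data.Vec using (Vec; toList)
open import Data.Product using (Σ; _×_; _,_)
open import Data.Rational as ℚ using (ℚ; 0ℚ; _+_; _≤_; _<_; _÷_; >-nonZero)
open import Relation.Binary.PropositionalEquality using (_≡_)

-- Vertices: Fin (suc n); zero is the depot v₀, suc i is customer v_{i+1}.
depot : ∀ {n} → Fin (suc n)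
depot = zero

record Metric (n : ℕ) : Set where
  field
    w      : Fin (suc n) → Fin (suc n) → ℚ
    nonneg : ∀ x y → 0ℚ ≤ w x y
    symm   : ∀ x y → w x y ≡ w y x
    tri    : ∀ x y z → w x z ≤ w x y + w y z
open Metric public

sumℚ : List ℚ → ℚ
sumℚ []       = 0ℚ
sumℚ (q ∷ qs) = q + sumℚ qs

module _ {n : ℕ} (M : Metric n) where

  pathW : Fin (suc n) → List (Fin n) → ℚ
  pathW x []       = w M x depot
  pathW x (u ∷ us) = w M x (suc u) + pathW (suc u) us

  routeW : List (Fin n) → ℚ
  routeW us = pathW depot us

  -- A (general) tour: a closed walk through v₀ visiting the customers of
  -- 'route' in order, serving the customers in 'served' (at most k, distinct,
  -- each visited by the route).
  record Tour (k : ℕ) : Set where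
    field
      route      : List (Fin n)
      served     : List (Fin n)
      servedUniq : Unique served
      servedOn   : ∀ {u} → u ∈ served → u ∈ route
      capacity   : length served ℕ.≤ k
  open Tour public

  record Itinerary (k : ℕ) : Set where
    field
      tours  : List (Tour k)
      covers : ∀ (u : Fin n) → Any (λ t → u ∈ served t) tours
  open Itinerary public

  itinW : ∀ {k} → Itinerary k → ℚ
  itinW I = sumℚ (map (λ t → routeW (route t)) (tours I))

  -- Simple itineraries as in the standing assumption: each tour is a simple
  -- cycle (v₀,u₁,…,u_k,v₀) serving exactly k customers, tours disjoint apart
  -- from v₀, all customers served exactly once.
  record SimpleItinerary (k : ℕ) : Set where
    field
      cycles    : List (Vec (Fin n) k)
      partition : concat (map toList cycles) ↭ allFin n
  open SimpleItinerary public

  simpleW : ∀ {k} → SimpleItinerary k → ℚ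
  simpleW I = sumℚ (map (λ c → routeW (toList c)) (cycles I))

  lastOr : Fin n → List (Fin n) → Fin n
  lastOr u []       = u
  lastOr _ (v ∷ vs) = lastOr v vs

  homeW : List (Fin n) → ℚ
  homeW []       = 0ℚ
  homeW (u ∷ us) = w M depot (suc u) + w M (suc (lastOr u us)) depot

  homeEdgesW : ∀ {k} → SimpleItinerary k → ℚ
  homeEdgesW I = sumℚ (map (λ c → homeW (toList c)) (cycles I))

  Optimal : ∀ {k} → SimpleItinerary k → Set
  Optimal {k} I = ∀ (J : Itinerary k) → simpleW I ≤ itinW J

  Δ : ℚ
  Δ = sumℚ (map (λ i → w M depot (suc i)) (allFin n))

chi : (a b : ℚ) → 0ℚ < b → ℚ
chi a b pos = _÷_ a b {{>-nonZero pos}}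

{-# OPTIONS --safe #-}
-- Δ is a sum of depot distances, one per customer, grouped by the tours of I*.
-- In a tour (v₀,u₁,…,u_k,v₀) of weight R the two home-edges pay for u₁ and u_k,
-- and every interior customer u_i is joined to v₀ by both arcs of the cycle, so
-- by the triangle inequality 2·w(v₀,u_i) ≤ R.  Hence a tour contributes at most
-- its home-edge weight plus (k−2)/2 · R, and summing over tours gives
-- Δ ≤ w(h(I*)) + (k−2)/2 · w(I*) = (χ + (k−2)/2) · w(I*).  The other inequality
-- is χ ≤ 1, i.e. the home-edges are part of the tours.
module Submission where

open import Defs
open import Data.Nat using (ℕ; _≥_)
open import Data.Integer using (+_; _-_)
open import Data.Rational using (ℚ; 0ℚ; _+_; _*_; _≤_; _<_; _/_)
open import Data.Product using (_×_)

open import Algebra.Bundles using (CommutativeMonoid)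
import Data.Nat as ℕ
open import Data.Nat using (suc; s≤s)
open import Data.Fin using (Fin)
open import Data.List using (List; []; _∷_; _++_; map; concat; length; foldr; allFin)
open import Data.List.Properties using (map-++; map-∘)
open import Data.List.Relation.Binary.Permutation.Propositional using (_↭_; ↭⇒↭ₛ)
open import Data.List.Relation.Binary.Permutation.Propositional.Properties using (map⁺)
open import Data.List.Relation.Binary.Permutation.Setoid.Properties using (foldr-commMonoid)
open import Data.Product using (_,_)
open import Data.Rational using (1ℚ; ½; 1/_; toℚᵘ; NonZero; >-nonZero)
open import Data.Rational.Properties
open import Data.Rational.Solver using (module +-*-Solver)
import Data.Integer.Solver as ℤ-Solver
import Data.Rational.Unnormalised as ℚᵘ
import Data.Rational.Unnormalised.Properties as ℚᵘ
open import Data.Vec using (Vec; toList) renaming (_∷_ to _∷ᵥ_)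
open import Data.Vec.Properties using (length-toList)
open import Relation.Binary.PropositionalEquality

sumℚ≡foldr : ∀ qs → sumℚ qs ≡ foldr _+_ 0ℚ qs
sumℚ≡foldr []       = refl
sumℚ≡foldr (q ∷ qs) = cong (_+_ q) (sumℚ≡foldr qs)

sumℚ-↭ : ∀ {ps qs} → ps ↭ qs → sumℚ ps ≡ sumℚ qs
sumℚ-↭ {ps} {qs} p = begin
  sumℚ ps             ≡⟨ sumℚ≡foldr ps ⟩
  foldr _+_ 0ℚ ps     ≡⟨ foldr-commMonoid +-0.setoid +-0.isCommutativeMonoid (↭⇒↭ₛ p) ⟩
  foldr _+_ 0ℚ qs     ≡⟨ sumℚ≡foldr qs ⟨
  sumℚ qs             ∎
  where
  open ≡-Reasoning
  module +-0 = CommutativeMonoid +-0-commutativeMonoid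

sumℚ-++ : ∀ ps qs → sumℚ (ps ++ qs) ≡ sumℚ ps + sumℚ qs
sumℚ-++ []       qs = sym (+-identityˡ (sumℚ qs))
sumℚ-++ (p ∷ ps) qs = trans (cong (_+_ p) (sumℚ-++ ps qs)) (sym (+-assoc p (sumℚ ps) (sumℚ qs)))

sumℚ-map-concat : ∀ {A : Set} (f : A → ℚ) xss → sumℚ (map f (concat xss)) ≡ sumℚ (map (λ xs → sumℚ (map f xs)) xss)
sumℚ-map-concat f []         = refl
sumℚ-map-concat f (xs ∷ xss) = begin
  sumℚ (map f (xs ++ concat xss))                  ≡⟨ cong sumℚ (map-++ f xs (concat xss)) ⟩
  sumℚ (map f xs ++ map f (concat xss))            ≡⟨ sumℚ-++ (map f xs) (map f (concat xss)) ⟩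
  sumℚ (map f xs) + sumℚ (map f (concat xss))      ≡⟨ cong (_+_ (sumℚ (map f xs))) (sumℚ-map-concat f xss) ⟩
  sumℚ (map f xs) + sumℚ (map (λ ys → sumℚ (map f ys)) xss)  ∎
  where open ≡-Reasoning

sumℚ-mono-≤ : ∀ {A : Set} {f g : A → ℚ} → (∀ x → f x ≤ g x) → ∀ xs → sumℚ (map f xs) ≤ sumℚ (map g xs)
sumℚ-mono-≤ f≤g []       = ≤-refl
sumℚ-mono-≤ f≤g (x ∷ xs) = +-mono-≤ (f≤g x) (sumℚ-mono-≤ f≤g xs)

sumℚ-+ : ∀ {A : Set} (f g : A → ℚ) xs → sumℚ (map (λ x → f x + g x) xs) ≡ sumℚ (map f xs) + sumℚ (map g xs)
sumℚ-+ f g []       = sym (+-identityˡ 0ℚ)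
sumℚ-+ f g (x ∷ xs) = trans (cong (_+_ (f x + g x)) (sumℚ-+ f g xs)) (+-assoc-middle (f x) (g x) _ _)
  where
  +-assoc-middle : ∀ a b c d → a + b + (c + d) ≡ a + c + (b + d)
  +-assoc-middle a b c d = solve 4 (λ a b c d → (a :+ b) :+ (c :+ d) := (a :+ c) :+ (b :+ d)) refl a b c d
    where open +-*-Solver

sumℚ-*ˡ : ∀ {A : Set} c (f : A → ℚ) xs → sumℚ (map (λ x → c * f x) xs) ≡ c * sumℚ (map f xs)
sumℚ-*ˡ c f []       = sym (*-zeroʳ c)
sumℚ-*ˡ c f (x ∷ xs) = trans (cong (_+_ (c * f x)) (sumℚ-*ˡ c f xs)) (sym (*-distribˡ-+ c (f x) _))

[m+n]/2≡m/2+n/2 : ∀ m n → + (m ℕ.+ n) / 2 ≡ + m / 2 + + n / 2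
[m+n]/2≡m/2+n/2 m n = toℚᵘ-injective (begin
  toℚᵘ (+ (m ℕ.+ n) / 2)                  ≈⟨ toℚᵘ-fromℚᵘ (ℚᵘ.mkℚᵘ (+ (m ℕ.+ n)) 1) ⟩
  ℚᵘ.mkℚᵘ (+ (m ℕ.+ n)) 1                 ≈⟨ ℚᵘ.*≡* (solve 2 (λ a b → (a :+ b) :* (two :* two) := (a :* two :+ b :* two) :* two) refl (+ m) (+ n)) ⟩
  ℚᵘ.mkℚᵘ (+ m) 1 ℚᵘ.+ ℚᵘ.mkℚᵘ (+ n) 1    ≈⟨ ℚᵘ.+-cong (toℚᵘ-fromℚᵘ (ℚᵘ.mkℚᵘ (+ m) 1)) (toℚᵘ-fromℚᵘ (ℚᵘ.mkℚᵘ (+ n) 1)) ⟨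
  toℚᵘ (+ m / 2) ℚᵘ.+ toℚᵘ (+ n / 2)      ≈⟨ toℚᵘ-homo-+ (+ m / 2) (+ n / 2) ⟨
  toℚᵘ (+ m / 2 + + n / 2)                ∎)
  where
  open ℚᵘ.≃-Reasoning
  open ℤ-Solver.+-*-Solver
  two = con (+ 2)

q+q≤r⇒q≤½r : ∀ {q r} → q + q ≤ r → q ≤ ½ * r
q+q≤r⇒q≤½r {q} {r} q+q≤r = begin
  q            ≡⟨ solve 1 (λ q → q := con ½ :* (q :+ q)) refl q ⟩
  ½ * (q + q)  ≤⟨ *-monoˡ-≤-nonNeg ½ q+q≤r ⟩
  ½ * r        ∎
  where
  open ≤-Reasoning
  open +-*-Solver

chi-* : ∀ a b (pos : 0ℚ < b) → chi a b pos * b ≡ a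
chi-* a b pos = begin
  a * 1/ b * b    ≡⟨ *-assoc a (1/ b) b ⟩
  a * (1/ b * b)  ≡⟨ cong (a *_) (*-inverseˡ b) ⟩
  a * 1ℚ          ≡⟨ *-identityʳ a ⟩
  a               ∎
  where
  open ≡-Reasoning
  instance
    b≢0 : NonZero b
    b≢0 = >-nonZero pos

module _ {n : ℕ} (M : Metric n) where

  d₀ : Fin n → ℚ
  d₀ i = w M depot (Fin.suc i)

  w-depot-≤-pathW : ∀ x us → w M x depot ≤ pathW M x us
  w-depot-≤-pathW x []       = ≤-refl
  w-depot-≤-pathW x (u ∷ us) =
    ≤-trans (tri M x (Fin.suc u) depot) (+-monoʳ-≤ (w M x (Fin.suc u)) (w-depot-≤-pathW (Fin.suc u) us))

  lastEdge-≤-pathW : ∀ u us → w M (Fin.suc (lastOr M u us)) depot ≤ pathW M (Fin.suc u) us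
  lastEdge-≤-pathW u []       = ≤-refl
  lastEdge-≤-pathW u (v ∷ us) = begin
    w M (Fin.suc (lastOr M v us)) depot      ≤⟨ lastEdge-≤-pathW v us ⟩
    pathW M (Fin.suc v) us                   ≡⟨ +-identityˡ _ ⟨
    0ℚ + pathW M (Fin.suc v) us              ≤⟨ +-monoˡ-≤ _ (nonneg M (Fin.suc u) (Fin.suc v)) ⟩
    pathW M (Fin.suc u) (v ∷ us)             ∎
    where open ≤-Reasoning

  homeW≤routeW : ∀ us → homeW M us ≤ routeW M us
  homeW≤routeW []       = nonneg M depot depot
  homeW≤routeW (u ∷ us) = +-monoʳ-≤ (d₀ u) (lastEdge-≤-pathW u us)

  -- a is the weight of a walk v₀ ⇝ x, so it bounds w(v₀,x); every customer of
  -- the walk but the last then lies on a cycle of weight a + pathW x (v ∷ vs)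
  -- and is at most half of it away from v₀.
  walk-sum-d₀-≤ : ∀ x a v vs → w M depot x ≤ a →
    sumℚ (map d₀ (v ∷ vs)) ≤ (+ length vs / 2) * (a + pathW M x (v ∷ vs)) + d₀ (lastOr M v vs)
  walk-sum-d₀-≤ x a v [] _ = ≤-reflexive (begin
    d₀ v + 0ℚ                         ≡⟨ +-identityʳ (d₀ v) ⟩
    d₀ v                              ≡⟨ +-identityˡ (d₀ v) ⟨
    0ℚ + d₀ v                         ≡⟨ cong (_+ d₀ v) (*-zeroˡ (a + pathW M x (v ∷ []))) ⟨
    0ℚ * (a + pathW M x (v ∷ [])) + d₀ v  ∎)
    where open ≡-Reasoning
  walk-sum-d₀-≤ x a v (v′ ∷ vs) w₀x≤a = begin
    d₀ v + sumℚ (map d₀ (v′ ∷ vs))    ≤⟨ +-mono-≤ (q+q≤r⇒q≤½r {d₀ v} 2d₀v≤L) (walk-sum-d₀-≤ sv a′ v′ vs w₀v≤a′) ⟩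
    ½ * L + (t * L + d₀ ℓ)            ≡⟨ +-assoc (½ * L) (t * L) (d₀ ℓ) ⟨
    ½ * L + t * L + d₀ ℓ              ≡⟨ cong (_+ d₀ ℓ) (*-distribʳ-+ L ½ t) ⟨
    (½ + t) * L + d₀ ℓ                ≡⟨ cong (λ s → s * L + d₀ ℓ) ([m+n]/2≡m/2+n/2 1 (length vs)) ⟨
    (+ suc (length vs) / 2) * L + d₀ ℓ
      ≡⟨ cong (λ l → (+ suc (length vs) / 2) * l + d₀ ℓ) (+-assoc a (w M x sv) (pathW M sv (v′ ∷ vs))) ⟩
    (+ suc (length vs) / 2) * (a + pathW M x (v ∷ v′ ∷ vs)) + d₀ ℓ  ∎
    where
    open ≤-Reasoning
    sv = Fin.suc v
    a′ = a + w M x sv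
    L  = a′ + pathW M sv (v′ ∷ vs)
    t  = + length vs / 2
    ℓ  = lastOr M v′ vs
    w₀v≤a′ : w M depot sv ≤ a′
    w₀v≤a′ = ≤-trans (tri M depot x sv) (+-monoˡ-≤ (w M x sv) w₀x≤a)
    2d₀v≤L : d₀ v + d₀ v ≤ L
    2d₀v≤L = +-mono-≤ w₀v≤a′ (≤-trans (≤-reflexive (symm M depot sv)) (w-depot-≤-pathW sv (v′ ∷ vs)))

  tour-sum-d₀-≤ : ∀ u v vs →
    sumℚ (map d₀ (u ∷ v ∷ vs)) ≤ homeW M (u ∷ v ∷ vs) + (+ length vs / 2) * routeW M (u ∷ v ∷ vs)
  tour-sum-d₀-≤ u v vs = begin
    d₀ u + sumℚ (map d₀ (v ∷ vs))     ≤⟨ +-monoʳ-≤ (d₀ u) (walk-sum-d₀-≤ (Fin.suc u) (d₀ u) v vs ≤-refl) ⟩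
    d₀ u + (t * R + d₀ ℓ)             ≡⟨ cong (λ e → d₀ u + (t * R + e)) (symm M depot (Fin.suc ℓ)) ⟩
    d₀ u + (t * R + w M (Fin.suc ℓ) depot)
      ≡⟨ solve 3 (λ a b c → a :+ (c :+ b) := (a :+ b) :+ c) refl (d₀ u) (w M (Fin.suc ℓ) depot) (t * R) ⟩
    d₀ u + w M (Fin.suc ℓ) depot + t * R  ∎
    where
    open ≤-Reasoning
    open +-*-Solver
    t = + length vs / 2
    R = routeW M (u ∷ v ∷ vs)
    ℓ = lastOr M v vs

  cycle-sum-d₀-≤ : ∀ {j} (c : Vec (Fin n) (2 ℕ.+ j)) →
    sumℚ (map d₀ (toList c)) ≤ homeW M (toList c) + (+ j / 2) * routeW M (toList c)
  cycle-sum-d₀-≤ (u ∷ᵥ v ∷ᵥ vs) =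
    subst (λ m → sumℚ (map d₀ (u ∷ v ∷ toList vs)) ≤ homeW M (u ∷ v ∷ toList vs) + (+ m / 2) * routeW M (u ∷ v ∷ toList vs))
          (length-toList vs) (tour-sum-d₀-≤ u v (toList vs))

  Δ≡sum-over-cycles : ∀ {k} (I : SimpleItinerary M k) →
    Δ M ≡ sumℚ (map (λ c → sumℚ (map d₀ (toList c))) (cycles I))
  Δ≡sum-over-cycles I = begin
    sumℚ (map d₀ (allFin n))                                     ≡⟨ sumℚ-↭ (map⁺ d₀ (partition I)) ⟨
    sumℚ (map d₀ (concat (map toList (cycles I))))               ≡⟨ sumℚ-map-concat d₀ (map toList (cycles I)) ⟩
    sumℚ (map (λ us → sumℚ (map d₀ us)) (map toList (cycles I)))  ≡⟨ cong sumℚ (map-∘ (cycles I)) ⟨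
    sumℚ (map (λ c → sumℚ (map d₀ (toList c))) (cycles I))       ∎
    where open ≡-Reasoning

  homeEdgesW≤simpleW : ∀ {k} (I : SimpleItinerary M k) → homeEdgesW M I ≤ simpleW M I
  homeEdgesW≤simpleW I = sumℚ-mono-≤ (λ c → homeW≤routeW (toList c)) (cycles I)

  Δ≤homeEdgesW+[k-2]/2*simpleW : ∀ {j} (I : SimpleItinerary M (2 ℕ.+ j)) →
    Δ M ≤ homeEdgesW M I + (+ j / 2) * simpleW M I
  Δ≤homeEdgesW+[k-2]/2*simpleW {j} I = begin
    Δ M                                                               ≡⟨ Δ≡sum-over-cycles I ⟩
    sumℚ (map (λ c → sumℚ (map d₀ (toList c))) (cycles I))           ≤⟨ sumℚ-mono-≤ cycle-sum-d₀-≤ (cycles I) ⟩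
    sumℚ (map (λ c → homeW M (toList c) + t * routeW M (toList c)) (cycles I))
      ≡⟨ sumℚ-+ (λ c → homeW M (toList c)) (λ c → t * routeW M (toList c)) (cycles I) ⟩
    homeEdgesW M I + sumℚ (map (λ c → t * routeW M (toList c)) (cycles I))
      ≡⟨ cong (_+_ (homeEdgesW M I)) (sumℚ-*ˡ t (λ c → routeW M (toList c)) (cycles I)) ⟩
    homeEdgesW M I + t * simpleW M I                                   ∎
    where
    open ≤-Reasoning
    t = + j / 2

lemma6 : ∀ (n k : ℕ) → k ≥ 3 → (M : Metric n) →
    (Istar : SimpleItinerary M k) → Optimal M Istar →
    (pos : 0ℚ < simpleW M Istar) →
      ((chi (homeEdgesW M Istar) (simpleW M Istar) pos + ((+ k - + 2) / 2)) * simpleW M Istar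
          ≤ ((+ k) / 2) * simpleW M Istar)
      × (Δ M ≤ (chi (homeEdgesW M Istar) (simpleW M Istar) pos + ((+ k - + 2) / 2)) * simpleW M Istar)
lemma6 n (suc (suc j)) (s≤s (s≤s _)) M I _ pos = χ+t≤k/2 , Δ≤χ+t
  where
  H = homeEdgesW M I
  W = simpleW M I
  t = + j / 2
  χ = chi H W pos
  [χ+t]W≡H+tW : (χ + t) * W ≡ H + t * W
  [χ+t]W≡H+tW = trans (*-distribʳ-+ W χ t) (cong (_+ t * W) (chi-* H W pos))
  χ+t≤k/2 : (χ + t) * W ≤ (+ (2 ℕ.+ j) / 2) * W
  χ+t≤k/2 = begin
    (χ + t) * W           ≡⟨ [χ+t]W≡H+tW ⟩
    H + t * W             ≤⟨ +-monoˡ-≤ (t * W) (homeEdgesW≤simpleW M I) ⟩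
    W + t * W             ≡⟨ cong (_+ t * W) (*-identityˡ W) ⟨
    1ℚ * W + t * W        ≡⟨ *-distribʳ-+ W 1ℚ t ⟨
    (1ℚ + t) * W          ≡⟨ cong (_* W) ([m+n]/2≡m/2+n/2 2 j) ⟨
    (+ (2 ℕ.+ j) / 2) * W ∎
    where open ≤-Reasoning
  Δ≤χ+t : Δ M ≤ (χ + t) * W
  Δ≤χ+t = ≤-trans (Δ≤homeEdgesW+[k-2]/2*simpleW M I) (≤-reflexive (sym [χ+t]W≡H+tW))
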